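{- For all integers $a$ and $c$ and all positive integers $b$, $$h(a,b-1,c)=h(a,b,c-1)-(x_b+y_c)\cdot h(a-1,b,c).$$
   Context: $R$ is the polynomial ring over $\mathbb{Z}$ in $x_1,x_2,\ldots,y_1,y_2,\ldots$; set $x_i=y_i=0$ for integers $i\le0$. For $a,c\in\mathbb{Z}$ and $b\in\mathbb{N}$, $h(a,b,c)=\sum_{(i_1,\ldots,i_a)\in[b]^a,\ i_1\le\cdots\le i_a}\prod_{j=1}^a(x_{i_j}+y_{i_j+(j-1)+c})$ with $[b]=\{1,\ldots,b\}$; this is $1$ when $a=0$ and is defined to be $0$ when $a<0$. -}

module Defs where

open import Level using (Level)
open import Data.Nat as ℕ using (ℕ; zero; suc)
open import Data.Integer as ℤ using (ℤ; +_; -[1+_])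
open import Data.List using (List; []; _∷_; [_]; map; concatMap; upTo; foldr)
open import Algebra.Bundles using (CommutativeRing)

range : ℕ → ℕ → List ℕ
range lo b = map (λ t → lo ℕ.+ t) (upTo (suc b ℕ.∸ lo))

incSeqs : ℕ → ℕ → ℕ → List (List ℕ)
incSeqs zero    lo b = [ [] ]
incSeqs (suc n) lo b = concatMap (λ i → map (i ∷_) (incSeqs n i b)) (range lo b)

module Poly {c ℓ : Level} (R : CommutativeRing c ℓ) where
  open CommutativeRing R

  -- A family of variables v_1, v_2, ... (given as f : ℕ → Carrier; f 0 unused),
  -- extended to all integer indices by v_i = 0 for i ≤ 0.
  var : (ℕ → Carrier) → ℤ → Carrier
  var f (+ zero)   = 0#
  var f (+ suc n)  = f (suc n)
  var f -[1+ n ]   = 0#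

  -- product over j = 1..length of (x_{i_j} + y_{i_j + (j-1) + c});
  -- the argument j below is the 0-based index j-1.
  prodFrom : (ℕ → Carrier) → (ℕ → Carrier) → ℤ → ℕ → List ℕ → Carrier
  prodFrom x y c j []       = 1#
  prodFrom x y c j (i ∷ is) =
    (var x (+ i) + var y ((+ i) ℤ.+ (+ j) ℤ.+ c)) * prodFrom x y c (suc j) is

  sumL : List Carrier → Carrier
  sumL = foldr _+_ 0#

  h : (ℕ → Carrier) → (ℕ → Carrier) → ℤ → ℕ → ℤ → Carrier
  h x y (+ n)    b c = sumL (map (prodFrom x y c 0) (incSeqs n 1 b))
  h x y -[1+ n ] b c = 0#

{-# OPTIONS --safe #-}
-- Splitting off the sequences whose last entry is b gives the recurrence
--   h(a,b,c) = h(a,b-1,c) + (x_b + y_{b+a-1+c}) h(a-1,b,c).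
-- Expand h(a,b,c-1) by it, rewrite h(a,b-1,c-1) and h(a-1,b,c-1) by the
-- identity (induction on a and b), and expand h(a,b-1,c) and h(a-1,b,c) on
-- the right by the recurrence: the two sides then differ only in that y_c and
-- y_{b+a-2+c} trade places between two linear factors, which changes neither
-- their sum nor their product.
module Submission where

open import Defs
open import Level using (Level)
open import Data.Nat using (ℕ; _≤_; _∸_)
open import Data.Integer as ℤ using (ℤ; +_)
open import Algebra.Bundles using (CommutativeRing)

open import Data.Nat as ℕ using (zero; suc; z≤n; s≤s)
open import Data.Nat.Properties as ℕₚ using (+-∸-assoc; m+[n∸m]≡n; n∸n≡0; m≤o∸n⇒m+n≤o; ≤-pred; m≤n⇒m≤1+n)
open import Function using (_∘_)
open import Data.Integer using (-[1+_])
open import Data.Integer.Tactic.RingSolver using (solve-∀)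
open import Data.List using (List; []; _∷_; [_]; _++_; map; concatMap; upTo)
open import Data.List.Properties using (map-++; map-∘; upTo-∷ʳ)
open import Data.List.Membership.Propositional using (_∈_)
open import Data.List.Membership.Propositional.Properties using (∈-map⁻; ∈-upTo⁻)
open import Data.List.Relation.Unary.Any using (here; there)
open import Data.Product using (_,_)
open import Data.Maybe using (nothing)
open import Relation.Binary.PropositionalEquality as ≡ using (_≡_; cong)
open import Tactic.RingSolver.Core.AlmostCommutativeRing using (fromCommutativeRing)
import Tactic.RingSolver.NonReflective as RingSolver
import Algebra.Properties.Ring as RingProperties
import Algebra.Properties.CommutativeSemigroup as CommutativeSemigroupProperties
import Relation.Binary.Reasoning.Setoid as SetoidReasoning

i+j+[k-1]≡i+[j-1]+k : ∀ i j k → i ℤ.+ j ℤ.+ (k ℤ.- ℤ.1ℤ) ≡ i ℤ.+ (j ℤ.- ℤ.1ℤ) ℤ.+ k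
i+j+[k-1]≡i+[j-1]+k = solve-∀

1+i+j+[k-1]≡i+j+k : ∀ i j k → ℤ.1ℤ ℤ.+ i ℤ.+ j ℤ.+ (k ℤ.- ℤ.1ℤ) ≡ i ℤ.+ j ℤ.+ k
1+i+j+[k-1]≡i+j+k = solve-∀

1+0+[k-1]≡k : ∀ k → ℤ.1ℤ ℤ.+ ℤ.0ℤ ℤ.+ (k ℤ.- ℤ.1ℤ) ≡ k
1+0+[k-1]≡k = solve-∀

range-suc : ∀ lo b → lo ≤ suc b → range lo (suc b) ≡ range lo b ++ [ suc b ]
range-suc lo b lo≤b+1 = begin
  map (lo ℕ.+_) (upTo (suc (suc b) ∸ lo))
    ≡⟨ cong (map (lo ℕ.+_) ∘ upTo) (+-∸-assoc 1 lo≤b+1) ⟩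
  map (lo ℕ.+_) (upTo (suc (suc b ∸ lo)))
    ≡⟨ cong (map (lo ℕ.+_)) (≡.sym (upTo-∷ʳ (suc b ∸ lo))) ⟩
  map (lo ℕ.+_) (upTo (suc b ∸ lo) ++ [ suc b ∸ lo ])
    ≡⟨ map-++ (lo ℕ.+_) (upTo (suc b ∸ lo)) [ suc b ∸ lo ] ⟩
  range lo b ++ [ lo ℕ.+ (suc b ∸ lo) ]
    ≡⟨ cong (λ i → range lo b ++ [ i ]) (m+[n∸m]≡n lo≤b+1) ⟩
  range lo b ++ [ suc b ]
    ∎
  where
  open ≡.≡-Reasoning

∈-range⇒≤ : ∀ {lo b i} → lo ≤ suc b → i ∈ range lo b → i ≤ b
∈-range⇒≤ {lo} {b} lo≤b+1 i∈ with ∈-map⁻ (lo ℕ.+_) i∈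
... | s , s∈ , ≡.refl =
  ≡.subst (_≤ b) (ℕₚ.+-comm s lo) (≤-pred (m≤o∸n⇒m+n≤o (suc s) lo≤b+1 (∈-upTo⁻ s∈)))

module _ {c ℓ : Level} (R : CommutativeRing c ℓ) where
  open CommutativeRing R hiding (zero)
  open Poly R
  open SetoidReasoning setoid
  open CommutativeSemigroupProperties +-commutativeSemigroup using (interchange)
  open CommutativeSemigroupProperties *-commutativeSemigroup using (x∙yz≈y∙xz)
  open RingSolver (fromCommutativeRing R (λ _ → nothing)) using (solve; _⊕_; _⊗_; _⊜_)

  x≈x+y*0 : ∀ u v → u ≈ u + v * 0#
  x≈x+y*0 u v = sym (trans (+-congˡ (zeroʳ v)) (+-identityʳ u))

  -- Both sides expand to A + (p + q + u + v) E + (q + u) (q + v) F.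
  +-*-exchange : ∀ A E F p q u v →
    (A + (p + u) * E) + (q + v) * (E + (q + u) * F) ≈
    (A + (p + v) * E) + (q + u) * (E + (q + v) * F)
  +-*-exchange A E F p q u v = begin
    (A + (p + u) * E) + (q + v) * (E + (q + u) * F)
      ≈⟨ collect A E F (p + u) (q + v) (q + u) ⟩
    (A + ((p + u) + (q + v)) * E) + ((q + v) * (q + u)) * F
      ≈⟨ +-cong (+-congˡ (*-congʳ (swap p u q v))) (*-congʳ (*-comm _ _)) ⟩
    (A + ((p + v) + (q + u)) * E) + ((q + u) * (q + v)) * F
      ≈⟨ collect A E F (p + v) (q + u) (q + v) ⟨
    (A + (p + v) * E) + (q + u) * (E + (q + v) * F)
      ∎
    where
    collect : ∀ A E F r s t → (A + r * E) + s * (E + t * F) ≈ (A + (r + s) * E) + (s * t) * F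
    collect = solve 6 (λ A E F r s t → ((A ⊕ r ⊗ E) ⊕ s ⊗ (E ⊕ t ⊗ F)) ⊜ ((A ⊕ (r ⊕ s) ⊗ E) ⊕ (s ⊗ t) ⊗ F)) refl
    swap : ∀ p u q v → (p + u) + (q + v) ≈ (p + v) + (q + u)
    swap = solve 4 (λ p u q v → ((p ⊕ u) ⊕ (q ⊕ v)) ⊜ ((p ⊕ v) ⊕ (q ⊕ u))) refl

  module _ {A : Set} (f : A → Carrier) where
    sumL-map-++ : ∀ xs ys → sumL (map f (xs ++ ys)) ≈ sumL (map f xs) + sumL (map f ys)
    sumL-map-++ []       ys = sym (+-identityˡ _)
    sumL-map-++ (z ∷ xs) ys = trans (+-congˡ (sumL-map-++ xs ys)) (sym (+-assoc _ _ _))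

    sumL-map-*ˡ : ∀ a xs → sumL (map (λ z → a * f z) xs) ≈ a * sumL (map f xs)
    sumL-map-*ˡ a []       = sym (zeroʳ a)
    sumL-map-*ˡ a (z ∷ xs) = trans (+-congˡ (sumL-map-*ˡ a xs)) (sym (distribˡ a _ _))

    sumL-map-+ : ∀ g xs → sumL (map (λ z → f z + g z) xs) ≈ sumL (map f xs) + sumL (map g xs)
    sumL-map-+ g []       = sym (+-identityˡ _)
    sumL-map-+ g (z ∷ xs) = trans (+-congˡ (sumL-map-+ g xs)) (interchange _ _ _ _)

    sumL-map-cong : ∀ {g} xs → (∀ {i} → i ∈ xs → f i ≈ g i) → sumL (map f xs) ≈ sumL (map g xs)
    sumL-map-cong []       f≈g = refl
    sumL-map-cong (z ∷ xs) f≈g = +-cong (f≈g (here ≡.refl)) (sumL-map-cong xs (f≈g ∘ there))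

  sumL-map-concatMap : ∀ {A B : Set} (f : B → Carrier) (g : A → List B) xs →
    sumL (map f (concatMap g xs)) ≈ sumL (map (λ i → sumL (map f (g i))) xs)
  sumL-map-concatMap f g []       = refl
  sumL-map-concatMap f g (i ∷ xs) =
    trans (sumL-map-++ f (g i) (concatMap g xs)) (+-congˡ (sumL-map-concatMap f g xs))

  sumL-range-suc : ∀ (f : ℕ → Carrier) lo b → lo ≤ suc b →
    sumL (map f (range lo (suc b))) ≈ sumL (map f (range lo b)) + f (suc b)
  sumL-range-suc f lo b lo≤b+1 = begin
    sumL (map f (range lo (suc b)))
      ≡⟨ cong (sumL ∘ map f) (range-suc lo b lo≤b+1) ⟩
    sumL (map f (range lo b ++ [ suc b ]))
      ≈⟨ sumL-map-++ f (range lo b) [ suc b ] ⟩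
    sumL (map f (range lo b)) + (f (suc b) + 0#)
      ≈⟨ +-congˡ (+-identityʳ _) ⟩
    sumL (map f (range lo b)) + f (suc b)
      ∎

  module _ (x y : ℕ → Carrier) where
    xy : ℕ → ℤ → Carrier
    xy i k = var x (+ i) + var y k

    xy-cong : ∀ i {k k′} → k ≡ k′ → xy i k ≈ xy i k′
    xy-cong i k≡k′ = reflexive (cong (xy i) k≡k′)

    hGen : ℕ → ℕ → ℕ → ℤ → ℕ → Carrier
    hGen n lo b c j = sumL (map (prodFrom x y c j) (incSeqs n lo b))

    hGen-expand : ∀ n lo b c j → hGen (suc n) lo b c j ≈
      sumL (map (λ i → xy i (+ i ℤ.+ + j ℤ.+ c) * hGen n i b c (suc j)) (range lo b))
    hGen-expand n lo b c j =
      trans (sumL-map-concatMap (prodFrom x y c j) (λ i → map (i ∷_) (incSeqs n i b)) (range lo b))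
            (sumL-map-cong _ (range lo b) (λ {i} _ → first-entry i))
      where
      first-entry : ∀ i → sumL (map (prodFrom x y c j) (map (i ∷_) (incSeqs n i b))) ≈
                          xy i (+ i ℤ.+ + j ℤ.+ c) * hGen n i b c (suc j)
      first-entry i = trans (reflexive (cong sumL (≡.sym (map-∘ (incSeqs n i b)))))
                            (sumL-map-*ˡ (prodFrom x y c (suc j)) _ (incSeqs n i b))

    hGen-empty : ∀ n b c j → hGen (suc n) (suc b) b c j ≈ 0#
    hGen-empty n b c j rewrite n∸n≡0 b = refl

    hGen-last : ∀ n lo b c j → lo ≤ suc b →
      hGen (suc n) lo (suc b) c j ≈
      hGen (suc n) lo b c j + xy (suc b) (+ suc b ℤ.+ + (j ℕ.+ n) ℤ.+ c) * hGen n lo (suc b) c j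
    hGen-last zero lo b c j lo≤b+1 = begin
      hGen 1 lo (suc b) c j
        ≈⟨ hGen-expand 0 lo (suc b) c j ⟩
      sumL (map (λ i → t i * hGen 0 i b c (suc j)) (range lo (suc b)))
        ≈⟨ sumL-range-suc _ lo b lo≤b+1 ⟩
      sumL (map (λ i → t i * hGen 0 i b c (suc j)) (range lo b)) + t (suc b) * hGen 0 lo b c j
        ≈⟨ +-cong (sym (hGen-expand 0 lo b c j))
                  (*-congʳ (xy-cong (suc b) (cong (λ n → + suc b ℤ.+ + n ℤ.+ c) (≡.sym (ℕₚ.+-identityʳ j))))) ⟩
      hGen 1 lo b c j + xy (suc b) (+ suc b ℤ.+ + (j ℕ.+ 0) ℤ.+ c) * hGen 0 lo (suc b) c j
        ∎
      where
      t : ℕ → Carrier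
      t i = xy i (+ i ℤ.+ + j ℤ.+ c)
    hGen-last (suc m) lo b c j lo≤b+1 = begin
      hGen (suc (suc m)) lo (suc b) c j
        ≈⟨ hGen-expand (suc m) lo (suc b) c j ⟩
      sumL (map (λ i → t i * hGen (suc m) i (suc b) c (suc j)) (range lo (suc b)))
        ≈⟨ sumL-map-cong _ (range lo (suc b)) (λ i∈ → split-last _ (∈-range⇒≤ (m≤n⇒m≤1+n lo≤b+1) i∈)) ⟩
      sumL (map (λ i → t i * hGen (suc m) i b c (suc j) + Y * (t i * hGen m i (suc b) c (suc j))) (range lo (suc b)))
        ≈⟨ sumL-map-+ _ _ (range lo (suc b)) ⟩
      sumL (map (λ i → t i * hGen (suc m) i b c (suc j)) (range lo (suc b))) +
      sumL (map (λ i → Y * (t i * hGen m i (suc b) c (suc j))) (range lo (suc b)))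
        ≈⟨ +-cong (sumL-range-suc _ lo b lo≤b+1) (sumL-map-*ˡ _ Y (range lo (suc b))) ⟩
      (sumL (map (λ i → t i * hGen (suc m) i b c (suc j)) (range lo b)) +
       t (suc b) * hGen (suc m) (suc b) b c (suc j)) +
      Y * sumL (map (λ i → t i * hGen m i (suc b) c (suc j)) (range lo (suc b)))
        ≈⟨ +-cong (trans (+-congˡ (trans (*-congˡ (hGen-empty m b c (suc j))) (zeroʳ _))) (+-identityʳ _))
                  (*-cong (xy-cong (suc b) (cong (λ n → + suc b ℤ.+ + n ℤ.+ c) (≡.sym (ℕₚ.+-suc j m))))
                          (sym (hGen-expand m lo (suc b) c j))) ⟩
      sumL (map (λ i → t i * hGen (suc m) i b c (suc j)) (range lo b)) +
      xy (suc b) (+ suc b ℤ.+ + (j ℕ.+ suc m) ℤ.+ c) * hGen (suc m) lo (suc b) c j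
        ≈⟨ +-congʳ (sym (hGen-expand (suc m) lo b c j)) ⟩
      hGen (suc (suc m)) lo b c j + xy (suc b) (+ suc b ℤ.+ + (j ℕ.+ suc m) ℤ.+ c) * hGen (suc m) lo (suc b) c j
        ∎
      where
      t : ℕ → Carrier
      t i = xy i (+ i ℤ.+ + j ℤ.+ c)
      Y : Carrier
      Y = xy (suc b) (+ suc b ℤ.+ + (suc j ℕ.+ m) ℤ.+ c)
      split-last : ∀ i → i ≤ suc b → t i * hGen (suc m) i (suc b) c (suc j) ≈
                   t i * hGen (suc m) i b c (suc j) + Y * (t i * hGen m i (suc b) c (suc j))
      split-last i i≤b+1 = trans (*-congˡ (hGen-last m i b c (suc j) i≤b+1))
                                 (trans (distribˡ _ _ _) (+-congˡ (x∙yz≈y∙xz _ _ _)))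

    h-last : ∀ a b c → h x y a (suc b) c ≈
      h x y a b c + xy (suc b) (+ suc b ℤ.+ (a ℤ.- + 1) ℤ.+ c) * h x y (a ℤ.- + 1) (suc b) c
    h-last (+ zero)  b c = x≈x+y*0 _ _
    h-last (+ suc n) b c = hGen-last n 1 b c 0 (s≤s z≤n)
    h-last -[1+ n ]  b c = x≈x+y*0 _ _

    h-one-shift : ∀ m c → h x y (+ suc m) 1 (c ℤ.- + 1) ≈ xy 1 c * h x y (+ m) 1 c
    h-one-shift zero c =
      trans (h-last (+ 1) 0 (c ℤ.- + 1)) (trans (+-identityˡ _) (*-congʳ (xy-cong 1 (1+0+[k-1]≡k c))))
    h-one-shift (suc m) c = begin
      h x y (+ suc (suc m)) 1 (c ℤ.- + 1)
        ≈⟨ trans (h-last (+ suc (suc m)) 0 (c ℤ.- + 1)) (+-identityˡ _) ⟩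
      xy 1 (+ 1 ℤ.+ + suc m ℤ.+ (c ℤ.- + 1)) * h x y (+ suc m) 1 (c ℤ.- + 1)
        ≈⟨ *-cong (xy-cong 1 (i+j+[k-1]≡i+[j-1]+k (+ 1) (+ suc m) c)) (h-one-shift m c) ⟩
      xy 1 (+ 1 ℤ.+ + m ℤ.+ c) * (xy 1 c * h x y (+ m) 1 c)
        ≈⟨ x∙yz≈y∙xz _ _ _ ⟩
      xy 1 c * (xy 1 (+ 1 ℤ.+ + m ℤ.+ c) * h x y (+ m) 1 c)
        ≈⟨ *-congˡ (sym (trans (h-last (+ suc m) 0 c) (+-identityˡ _))) ⟩
      xy 1 c * h x y (+ suc m) 1 c
        ∎

    h-shift : ∀ a b c → h x y a (suc b) (c ℤ.- + 1) ≈
      h x y a b c + xy (suc b) c * h x y (a ℤ.- + 1) (suc b) c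
    h-shift -[1+ n ]  b       c = x≈x+y*0 _ _
    h-shift (+ zero)  b       c = x≈x+y*0 _ _
    h-shift (+ suc m) zero    c = trans (h-one-shift m c) (sym (+-identityˡ _))
    h-shift (+ suc m) (suc b) c = begin
      h x y (+ suc m) (suc (suc b)) (c ℤ.- + 1)
        ≈⟨ h-last (+ suc m) (suc b) (c ℤ.- + 1) ⟩
      h x y (+ suc m) (suc b) (c ℤ.- + 1) + xy (suc (suc b)) t * h x y (+ m) (suc (suc b)) (c ℤ.- + 1)
        ≈⟨ +-cong (h-shift (+ suc m) b c) (*-congˡ (h-shift (+ m) (suc b) c)) ⟩
      (h x y (+ suc m) b c + xy (suc b) c * h x y (+ m) (suc b) c) +
      xy (suc (suc b)) t * (h x y (+ m) (suc b) c + xy (suc (suc b)) c * h x y (+ m ℤ.- + 1) (suc (suc b)) c)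
        ≈⟨ +-*-exchange _ _ _ _ _ _ _ ⟩
      (h x y (+ suc m) b c + xy (suc b) t * h x y (+ m) (suc b) c) +
      xy (suc (suc b)) c * (h x y (+ m) (suc b) c + xy (suc (suc b)) t * h x y (+ m ℤ.- + 1) (suc (suc b)) c)
        ≈⟨ +-cong (+-congˡ (*-congʳ (xy-cong (suc b) (1+i+j+[k-1]≡i+j+k (+ suc b) (+ m) c))))
                  (*-congˡ (+-congˡ (*-congʳ (xy-cong (suc (suc b)) (i+j+[k-1]≡i+[j-1]+k (+ suc (suc b)) (+ m) c))))) ⟩
      (h x y (+ suc m) b c + xy (suc b) (+ suc b ℤ.+ + m ℤ.+ c) * h x y (+ m) (suc b) c) +
      xy (suc (suc b)) c * (h x y (+ m) (suc b) c +
                            xy (suc (suc b)) (+ suc (suc b) ℤ.+ (+ m ℤ.- + 1) ℤ.+ c) * h x y (+ m ℤ.- + 1) (suc (suc b)) c)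
        ≈⟨ sym (+-cong (h-last (+ suc m) b c) (*-congˡ (h-last (+ m) (suc b) c))) ⟩
      h x y (+ suc m) (suc b) c + xy (suc (suc b)) c * h x y (+ m) (suc (suc b)) c
        ∎
      where
      t : ℤ
      t = + suc (suc b) ℤ.+ + m ℤ.+ (c ℤ.- + 1)

corollary7p7 : ∀ {c ℓ : Level} (R : CommutativeRing c ℓ) →
    let open CommutativeRing R in let open Poly R in
    (x y : ℕ → Carrier) (a : ℤ) (b : ℕ) (k : ℤ) → 1 ≤ b →
    h x y a (b ∸ 1) k ≈ h x y a b (k ℤ.- + 1) - (var x (+ b) + var y k) * h x y (a ℤ.- + 1) b k
corollary7p7 R x y a (suc b) k _ =
  x≈z//y _ _ _ (sym (h-shift R x y a b k))
  where
  open CommutativeRing R using (sym)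
  open RingProperties (CommutativeRing.ring R) using (x≈z//y)
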